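{- Let $w$ be a word in the Weyl algebra (generated by $D,U$ with $DU=UD+1$) composed of $n$ letters $D$ and $m$ letters $U$. For $1\le i\le n$ let $h_i$ be the number of letters $U$ occurring to the right of the $i$-th $D$ of $w$ (counting $D$'s from the left), and let $P(x)=\prod_{i=1}^{n}(x+h_i-n+i)$. Then $$w=\sum_{k=0}^{n} r_k\,U^{m-k}D^{n-k},\qquad\text{where}\qquad r_k=\frac{1}{(n-k)!}\sum_{i=0}^{n-k}(-1)^{n-k-i}\binom{n-k}{i}P(i).$$
   Context: The numbers $h_1\ge h_2\ge\dots\ge h_n\ge 0$ are the column heights of the Ferrers board outlined by $w$. Negative powers of $U$ or $D$ do not occur with nonzero coefficient. -}

module Defs where

open import Level using (Level)
open import Data.Nat as ℕ using (ℕ; zero; suc; _∸_)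
open import Data.Nat.Combinatorics using (_C_)
open import Data.Integer as ℤ using (ℤ; +_; -[1+_])
open import Data.List using (List; []; _∷_)
open import Algebra.Bundles using (Ring)

data Letter : Set where
  𝐃 𝐔 : Letter

Word : Set
Word = List Letter

#D : Word → ℕ
#D [] = 0
#D (𝐃 ∷ w) = suc (#D w)
#D (𝐔 ∷ w) = #D w

#U : Word → ℕ
#U [] = 0
#U (𝐃 ∷ w) = #U w
#U (𝐔 ∷ w) = suc (#U w)

heights : Word → List ℕ
heights [] = []
heights (𝐃 ∷ w) = #U w ∷ heights w
heights (𝐔 ∷ w) = heights w

PAux : ℕ → ℕ → List ℕ → ℤ → ℤ
PAux n i [] x = ℤ.1ℤ
PAux n i (h ∷ hs) x = ((x ℤ.+ + h) ℤ.- + n ℤ.+ + i) ℤ.* PAux n (suc i) hs x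

P : Word → ℤ → ℤ
P w x = PAux (#D w) 1 (heights w) x

Σℤ : ℕ → (ℕ → ℤ) → ℤ
Σℤ zero f = f 0
Σℤ (suc N) f = Σℤ N f ℤ.+ f (suc N)

-- S w k = Σ_{i=0}^{n-k} (-1)^{n-k-i} binom(n-k, i) P(i)
-- (so that r_k = S w k / (n-k)!)
S : Word → ℕ → ℤ
S w k = Σℤ (n ∸ k) (λ i → ((ℤ.- ℤ.1ℤ) ℤ.^ ((n ∸ k) ∸ i)) ℤ.* (+ ((n ∸ k) C i)) ℤ.* P w (+ i))
  where n = #D w

module RingOps {c ℓ : Level} (R : Ring c ℓ) where
  open Ring R

  ℕ→R : ℕ → Carrier
  ℕ→R zero = 0#
  ℕ→R (suc n) = 1# + ℕ→R n

  ℤ→R : ℤ → Carrier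
  ℤ→R (+ n) = ℕ→R n
  ℤ→R -[1+ n ] = - ℕ→R (suc n)

  pow : Carrier → ℕ → Carrier
  pow x zero = 1#
  pow x (suc k) = x * pow x k

  ΣR : ℕ → (ℕ → Carrier) → Carrier
  ΣR zero f = f 0
  ΣR (suc N) f = ΣR N f + f (suc N)

  eval : Carrier → Carrier → Word → Carrier
  eval d u [] = 1#
  eval d u (𝐃 ∷ w) = d * eval d u w
  eval d u (𝐔 ∷ w) = u * eval d u w

-- Let r_k be the rook numbers of the Ferrers board of w, computed column by column. Moving d to
-- the right past powers of u with d uʲ = uʲ d + j uʲ⁻¹ shows, by induction on w, that
-- w = Σ_k r_k U^(m-k) D^(n-k). The same column recursion proves the factorization theorem
-- P(x) = Σ_l r_l (x)_(n-l), where (x)_a is the falling factorial x P′ a. The j-th forward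
-- difference at 0 sends (x)_a to j! if a = j and to 0 otherwise; for j = n - k it therefore
-- extracts (n - k)! r_k from P, and that forward difference is exactly S w k.
module Submission where

open import Defs
open import Level using (Level)
open import Algebra.Bundles using (Ring)
open import Data.Nat as ℕ using (ℕ; zero; suc; pred; _∸_; _≤_; _<_; _!; z≤n; s≤s)
import Data.Nat.Properties as ℕ
open import Data.List using ([]; _∷_)
open import Data.Empty using (⊥-elim)
open import Relation.Binary.Definitions using (tri<; tri≈; tri>)
open import Data.Sum using (inj₁; inj₂)
open import Relation.Nullary using (¬_; yes; no)
open import Relation.Binary.PropositionalEquality as ≡ using (_≡_; refl)
open import Data.Nat.Combinatorics using (_C_; nCk+nC[k+1]≡[n+1]C[k+1]; k>n⇒nCk≡0)
open import Data.Nat.Combinatorics.Base using (_P′_)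
open import Data.Nat.Combinatorics.Specification using (nP′k≡n[n∸1P′k∸1]; nP′n≡n!)

-- rook w k is r_k, the number of ways to put k non-attacking rooks on the Ferrers board of w.
-- A leading 𝐃 adds a column of height #U w, at least as tall as all the others, in which k rooks
-- already placed leave #U w ∸ k free cells.
rook : Word → ℕ → ℕ
rook []      zero    = 1
rook []      (suc k) = 0
rook (𝐔 ∷ w) k       = rook w k
rook (𝐃 ∷ w) zero    = rook w zero
rook (𝐃 ∷ w) (suc k) = rook w (suc k) ℕ.+ (#U w ∸ k) ℕ.* rook w k

#U<k⇒rook≡0 : ∀ w {k} → #U w < k → rook w k ≡ 0
#U<k⇒rook≡0 []      {suc k} _           = refl
#U<k⇒rook≡0 (𝐔 ∷ w)         m<k         = #U<k⇒rook≡0 w (ℕ.<-trans (ℕ.n<1+n _) m<k)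
#U<k⇒rook≡0 (𝐃 ∷ w) {suc k} (s≤s m≤k)
  rewrite #U<k⇒rook≡0 w (s≤s m≤k) | ℕ.m≤n⇒m∸n≡0 m≤k = refl

#D<k⇒rook≡0 : ∀ w {k} → #D w < k → rook w k ≡ 0
#D<k⇒rook≡0 []      {suc k} _           = refl
#D<k⇒rook≡0 (𝐔 ∷ w)         n<k         = #D<k⇒rook≡0 w n<k
#D<k⇒rook≡0 (𝐃 ∷ w) {suc k} (s≤s n<k)
  rewrite #D<k⇒rook≡0 w (ℕ.m<n⇒m<1+n n<k) | #D<k⇒rook≡0 w n<k = ℕ.*-zeroʳ (#U w ∸ k)

module ΣR-Properties {c ℓ : Level} (R : Ring c ℓ) where
  open Ring R hiding (zero) renaming (refl to ≈-refl)
  open RingOps R using (ΣR)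
  open import Relation.Binary.Reasoning.Setoid setoid
  open import Algebra.Properties.CommutativeSemigroup +-commutativeSemigroup using (interchange)

  ΣR-cong : ∀ N {f g} → (∀ k → k ≤ N → f k ≈ g k) → ΣR N f ≈ ΣR N g
  ΣR-cong zero    f≈g = f≈g 0 z≤n
  ΣR-cong (suc N) f≈g =
    +-cong (ΣR-cong N (λ k k≤N → f≈g k (ℕ.m≤n⇒m≤1+n k≤N))) (f≈g (suc N) ℕ.≤-refl)

  ΣR-distrib-+ : ∀ N f g → ΣR N (λ k → f k + g k) ≈ ΣR N f + ΣR N g
  ΣR-distrib-+ zero    f g = ≈-refl
  ΣR-distrib-+ (suc N) f g = trans (+-congʳ (ΣR-distrib-+ N f g)) (interchange _ _ _ _)

  *-distribˡ-ΣR : ∀ N x f → x * ΣR N f ≈ ΣR N (λ k → x * f k)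
  *-distribˡ-ΣR zero    x f = ≈-refl
  *-distribˡ-ΣR (suc N) x f = trans (distribˡ x _ _) (+-congʳ (*-distribˡ-ΣR N x f))

  ΣR-comm : ∀ N M (f : ℕ → ℕ → Carrier) →
            ΣR N (λ i → ΣR M (f i)) ≈ ΣR M (λ l → ΣR N (λ i → f i l))
  ΣR-comm zero    M f = ≈-refl
  ΣR-comm (suc N) M f = trans (+-congʳ (ΣR-comm N M f))
                              (sym (ΣR-distrib-+ M (λ l → ΣR N (λ i → f i l)) (f (suc N))))

  ΣR-zero : ∀ N f → (∀ k → k ≤ N → f k ≈ 0#) → ΣR N f ≈ 0#
  ΣR-zero zero    f f≈0 = f≈0 0 z≤n
  ΣR-zero (suc N) f f≈0 =
    trans (+-cong (ΣR-zero N f (λ k k≤N → f≈0 k (ℕ.m≤n⇒m≤1+n k≤N))) (f≈0 (suc N) ℕ.≤-refl))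
          (+-identityˡ 0#)

  ΣR-single : ∀ N {k} f → k ≤ N → (∀ l → l ≤ N → ¬ l ≡ k → f l ≈ 0#) → ΣR N f ≈ f k
  ΣR-single zero    f z≤n  f≈0 = ≈-refl
  ΣR-single (suc N) f k≤1+N f≈0 with ℕ.m≤n⇒m<n∨m≡n k≤1+N
  ... | inj₁ (s≤s k≤N) = begin
    ΣR N f + f (suc N) ≈⟨ +-cong (ΣR-single N f k≤N (λ l l≤N → f≈0 l (ℕ.m≤n⇒m≤1+n l≤N)))
                                 (f≈0 (suc N) ℕ.≤-refl (λ { refl → ℕ.<-irrefl refl (s≤s k≤N) })) ⟩
    f _ + 0#           ≈⟨ +-identityʳ _ ⟩
    f _                ∎
  ... | inj₂ refl = begin
    ΣR N f + f (suc N) ≈⟨ +-congʳ (ΣR-zero N f (λ l l≤N → f≈0 l (ℕ.m≤n⇒m≤1+n l≤N)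
                                                      (λ { refl → ℕ.<-irrefl refl (s≤s l≤N) }))) ⟩
    0# + f (suc N)     ≈⟨ +-identityˡ _ ⟩
    f (suc N)          ∎

  ΣR-shift : ∀ N f → ΣR (suc N) f ≈ f 0 + ΣR N (λ k → f (suc k))
  ΣR-shift zero    f = ≈-refl
  ΣR-shift (suc N) f = trans (+-congʳ (ΣR-shift N f)) (+-assoc _ _ _)

  ΣR-pascal : ∀ N (t A B : ℕ → Carrier) → t 0 ≈ A 0 →
              (∀ k → k ≤ N → t (suc k) ≈ A (suc k) + B k) → A (suc N) ≈ 0# →
              ΣR (suc N) t ≈ ΣR N A + ΣR N B
  ΣR-pascal N t A B t₀≈A₀ t≈A+B A[1+N]≈0 = begin
    ΣR (suc N) t                              ≈⟨ ΣR-shift N t ⟩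
    t 0 + ΣR N (λ k → t (suc k))              ≈⟨ +-cong t₀≈A₀ (ΣR-cong N t≈A+B) ⟩
    A 0 + ΣR N (λ k → A (suc k) + B k)        ≈⟨ +-congˡ (ΣR-distrib-+ N _ B) ⟩
    A 0 + (ΣR N (λ k → A (suc k)) + ΣR N B)   ≈⟨ +-assoc _ _ _ ⟨
    (A 0 + ΣR N (λ k → A (suc k))) + ΣR N B   ≈⟨ +-congʳ (ΣR-shift N A) ⟨
    (ΣR N A + A (suc N)) + ΣR N B             ≈⟨ +-congʳ (trans (+-congˡ A[1+N]≈0) (+-identityʳ _)) ⟩
    ΣR N A + ΣR N B                           ∎

module NormalOrdering {c ℓ : Level} (R : Ring c ℓ) (d u : Ring.Carrier R)
                      (du≈ud+1 : Ring._≈_ R (Ring._*_ R d u) (Ring._+_ R (Ring._*_ R u d) (Ring.1# R)))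
                      where
  open Ring R hiding (zero) renaming (refl to ≈-refl)
  open RingOps R
  open ΣR-Properties R
  open import Algebra.Properties.Semiring.Mult semiring
    using (_×_; ×-congˡ; ×-congʳ; ×-homo-+; ×-assocˡ; ×-comm-*; ×-assoc-*)
  open import Algebra.Properties.CommutativeMonoid.Mult +-commutativeMonoid using (×-distrib-+)
  open import Relation.Binary.Reasoning.Setoid setoid

  ℕ→R-*≈× : ∀ n x → ℕ→R n * x ≈ n × x
  ℕ→R-*≈× zero    x = zeroˡ x
  ℕ→R-*≈× (suc n) x = trans (distribʳ x 1# (ℕ→R n)) (+-cong (*-identityˡ x) (ℕ→R-*≈× n x))

  u*[j×uʲ⁻¹]≈j×uʲ : ∀ j → u * (j × pow u (pred j)) ≈ j × pow u j
  u*[j×uʲ⁻¹]≈j×uʲ zero    = zeroʳ u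
  u*[j×uʲ⁻¹]≈j×uʲ (suc j) = ×-comm-* (suc j) u (pow u j)

  d*uʲ : ∀ j → d * pow u j ≈ pow u j * d + j × pow u (pred j)
  d*uʲ zero    = trans (*-identityʳ d) (trans (sym (*-identityˡ d)) (sym (+-identityʳ _)))
  d*uʲ (suc j) = begin
    d * (u * pow u j)                               ≈⟨ *-assoc d u _ ⟨
    (d * u) * pow u j                               ≈⟨ *-congʳ du≈ud+1 ⟩
    (u * d + 1#) * pow u j                          ≈⟨ distribʳ _ _ _ ⟩
    (u * d) * pow u j + 1# * pow u j                ≈⟨ +-cong (*-assoc u d _) (*-identityˡ _) ⟩
    u * (d * pow u j) + pow u j                     ≈⟨ +-congʳ (*-congˡ (d*uʲ j)) ⟩
    u * (pow u j * d + j × pow u (pred j)) + pow u j ≈⟨ +-congʳ (distribˡ u _ _) ⟩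
    (u * (pow u j * d) + u * (j × pow u (pred j))) + pow u j
                                                    ≈⟨ +-assoc _ _ _ ⟩
    u * (pow u j * d) + (u * (j × pow u (pred j)) + pow u j)
                                                    ≈⟨ +-cong (*-assoc u _ d) (+-comm _ _) ⟨
    pow u (suc j) * d + (pow u j + u * (j × pow u (pred j)))
                                                    ≈⟨ +-congˡ (+-congˡ (u*[j×uʲ⁻¹]≈j×uʲ j)) ⟩
    pow u (suc j) * d + suc j × pow u j             ∎

  u*monomial : ∀ r i e → u * (r × (pow u i * pow d e)) ≈ r × (pow u (suc i) * pow d e)
  u*monomial r i e = trans (×-comm-* r u _) (×-congʳ r (sym (*-assoc u _ _)))

  d*monomial : ∀ r i e → d * (r × (pow u i * pow d e)) ≈
               r × (pow u i * pow d (suc e)) + (i ℕ.* r) × (pow u (pred i) * pow d e)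
  d*monomial r i e = begin
    d * (r × (pow u i * pow d e))                            ≈⟨ ×-comm-* r d _ ⟩
    r × (d * (pow u i * pow d e))                            ≈⟨ ×-congʳ r (sym (*-assoc d _ _)) ⟩
    r × ((d * pow u i) * pow d e)                            ≈⟨ ×-congʳ r (*-congʳ (d*uʲ i)) ⟩
    r × ((pow u i * d + i × pow u (pred i)) * pow d e)       ≈⟨ ×-congʳ r (distribʳ _ _ _) ⟩
    r × ((pow u i * d) * pow d e + (i × pow u (pred i)) * pow d e)
                                                             ≈⟨ ×-congʳ r (+-cong (*-assoc _ d _) (×-assoc-* i _ _)) ⟩
    r × (pow u i * pow d (suc e) + i × (pow u (pred i) * pow d e))
                                                             ≈⟨ ×-distrib-+ _ _ r ⟩
    r × (pow u i * pow d (suc e)) + r × (i × (pow u (pred i) * pow d e))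
                                                             ≈⟨ +-congˡ (×-assocˡ _ r i) ⟩
    r × (pow u i * pow d (suc e)) + (r ℕ.* i) × (pow u (pred i) * pow d e)
                                                             ≈⟨ +-congˡ (×-congˡ (ℕ.*-comm r i)) ⟩
    r × (pow u i * pow d (suc e)) + (i ℕ.* r) × (pow u (pred i) * pow d e) ∎

  normalTerm : Word → ℕ → Carrier
  normalTerm w k = rook w k × (pow u (#U w ∸ k) * pow d (#D w ∸ k))

  normalOrdering : ∀ w → eval d u w ≈ ΣR (#D w) (normalTerm w)
  normalOrdering []      = sym (trans (+-identityʳ _) (*-identityʳ 1#))
  normalOrdering (𝐔 ∷ w) = begin
    u * eval d u w                           ≈⟨ *-congˡ (normalOrdering w) ⟩
    u * ΣR (#D w) (normalTerm w)             ≈⟨ *-distribˡ-ΣR (#D w) u _ ⟩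
    ΣR (#D w) (λ k → u * normalTerm w k)     ≈⟨ ΣR-cong (#D w) (λ k _ → u*term k) ⟩
    ΣR (#D w) (normalTerm (𝐔 ∷ w))           ∎
    where
    u*term : ∀ k → u * normalTerm w k ≈ normalTerm (𝐔 ∷ w) k
    u*term k with k ℕ.≤? #U w
    ... | yes k≤m rewrite ℕ.+-∸-assoc 1 k≤m = u*monomial (rook w k) (#U w ∸ k) (#D w ∸ k)
    ... | no  k≰m rewrite #U<k⇒rook≡0 w (ℕ.≰⇒> k≰m) = zeroʳ u
  normalOrdering (𝐃 ∷ w) = begin
    d * eval d u w                           ≈⟨ *-congˡ (normalOrdering w) ⟩
    d * ΣR n (normalTerm w)                  ≈⟨ *-distribˡ-ΣR n d _ ⟩
    ΣR n (λ k → d * normalTerm w k)          ≈⟨ ΣR-cong n d*term ⟩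
    ΣR n (λ k → A k + B k)                   ≈⟨ ΣR-distrib-+ n A B ⟩
    ΣR n A + ΣR n B                          ≈⟨ ΣR-pascal n (normalTerm (𝐃 ∷ w)) A B ≈-refl
                                                  (λ k _ → ×-homo-+ _ (rook w (suc k)) _) A[1+n]≈0 ⟨
    ΣR (suc n) (normalTerm (𝐃 ∷ w))          ∎
    where
    n = #D w
    m = #U w
    A B : ℕ → Carrier
    A k = rook w k × (pow u (m ∸ k) * pow d (suc n ∸ k))
    B k = ((m ∸ k) ℕ.* rook w k) × (pow u (m ∸ suc k) * pow d (n ∸ k))
    A[1+n]≈0 : A (suc n) ≈ 0#
    A[1+n]≈0 rewrite #D<k⇒rook≡0 w (ℕ.n<1+n n) = ≈-refl
    d*term : ∀ k → k ≤ n → d * normalTerm w k ≈ A k + B k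
    d*term k k≤n rewrite ℕ.+-∸-assoc 1 k≤n | ≡.sym (ℕ.pred[m∸n]≡m∸[1+n] m k) =
      d*monomial (rook w k) (m ∸ k) (n ∸ k)

open import Data.Integer as ℤ using (ℤ; +_; 0ℤ; 1ℤ; _*_; _-_)
import Data.Integer.Properties as ℤ
open import Data.Integer.Tactic.RingSolver using (solve-∀)
open ≡.≡-Reasoning

open RingOps ℤ.+-*-ring using (ΣR)
open ΣR-Properties ℤ.+-*-ring

-- Truncated subtraction makes x P′ a the falling factorial x (x - 1) ⋯ (x - a + 1) for every a,
-- including a > x, where it vanishes.
<⇒P′≡0 : ∀ {x a} → x < a → x P′ a ≡ 0
<⇒P′≡0 {x} {suc a} (s≤s x≤a) rewrite ℕ.m≤n⇒m∸n≡0 x≤a = refl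

P′-suc : ∀ x a → + (x P′ suc a) ≡ (+ x - + a) * + (x P′ a)
P′-suc x a with a ℕ.≤? x
... | yes a≤x = begin
  + ((x ∸ a) ℕ.* (x P′ a))   ≡⟨ ℤ.pos-* (x ∸ a) _ ⟩
  + (x ∸ a) * + (x P′ a)     ≡⟨ ≡.cong (_* + (x P′ a)) (≡.trans (ℤ.m-n≡m⊖n x a) (ℤ.⊖-≥ a≤x)) ⟨
  (+ x - + a) * + (x P′ a)   ∎
... | no  a≰x rewrite <⇒P′≡0 (ℕ.≰⇒> a≰x) | ℕ.*-zeroʳ (x ∸ a) = ≡.sym (ℤ.*-zeroʳ (+ x - + a))

P′-suc-suc : ∀ x b → + (suc x P′ suc b) ≡ + (x P′ suc b) ℤ.+ + suc b * + (x P′ b)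
P′-suc-suc x b = begin
  + (suc x P′ suc b)                            ≡⟨ ≡.cong +_ (nP′k≡n[n∸1P′k∸1] (suc x) (suc b)) ⟩
  + (suc x ℕ.* (x P′ b))                        ≡⟨ ℤ.pos-* (suc x) _ ⟩
  + suc x * + (x P′ b)                          ≡⟨ expand (+ x) (+ b) (+ (x P′ b)) ⟩
  (+ x - + b) * + (x P′ b) ℤ.+ + suc b * + (x P′ b) ≡⟨ ≡.cong (ℤ._+ (+ suc b * + (x P′ b))) (P′-suc x b) ⟨
  + (x P′ suc b) ℤ.+ + suc b * + (x P′ b)       ∎
  where
  expand : ∀ x b f → (1ℤ ℤ.+ x) * f ≡ (x - b) * f ℤ.+ (1ℤ ℤ.+ b) * f
  expand = solve-∀

PAux-suc-suc : ∀ n i hs y → PAux (suc n) (suc i) hs y ≡ PAux n i hs y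
PAux-suc-suc n i []       y = refl
PAux-suc-suc n i (h ∷ hs) y = ≡.cong₂ _*_ (shift (y ℤ.+ + h) (+ n) (+ i)) (PAux-suc-suc n (suc i) hs y)
  where
  shift : ∀ a n i → a - (1ℤ ℤ.+ n) ℤ.+ (1ℤ ℤ.+ i) ≡ a - n ℤ.+ i
  shift = solve-∀

P-𝐃 : ∀ w y → P (𝐃 ∷ w) y ≡ (y ℤ.+ + #U w - + #D w) * P w y
P-𝐃 w y = ≡.cong₂ _*_ (shift (y ℤ.+ + #U w) (+ #D w)) (PAux-suc-suc (#D w) 1 (heights w) y)
  where
  shift : ∀ a n → a - (1ℤ ℤ.+ n) ℤ.+ 1ℤ ≡ a - n
  shift = solve-∀

-- x + m - n = (x - a) + mₗ, and (x - a) · x P′ a = x P′ (a + 1).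
falling-step : ∀ x {m n} l a mₗ c → mₗ ℕ.+ l ≡ m → a ℕ.+ l ≡ n →
               (+ x ℤ.+ + m - + n) * (+ c * + (x P′ a)) ≡
               + c * + (x P′ suc a) ℤ.+ + (mₗ ℕ.* c) * + (x P′ a)
falling-step x l a mₗ c refl refl = begin
  (+ x ℤ.+ + (mₗ ℕ.+ l) - + (a ℕ.+ l)) * (+ c * F)
    ≡⟨ ≡.cong₂ (λ p q → (+ x ℤ.+ p - q) * (+ c * F)) (ℤ.pos-+ mₗ l) (ℤ.pos-+ a l) ⟩
  (+ x ℤ.+ (+ mₗ ℤ.+ + l) - (+ a ℤ.+ + l)) * (+ c * F)
    ≡⟨ regroup (+ x) (+ mₗ) (+ l) (+ a) (+ c) F ⟩
  + c * ((+ x - + a) * F) ℤ.+ (+ mₗ * + c) * F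
    ≡⟨ ≡.cong₂ (λ p q → + c * p ℤ.+ q * F) (P′-suc x a) (ℤ.pos-* mₗ c) ⟨
  + c * + (x P′ suc a) ℤ.+ + (mₗ ℕ.* c) * F
    ∎
  where
  F = + (x P′ a)
  regroup : ∀ x m l a c f → (x ℤ.+ (m ℤ.+ l) - (a ℤ.+ l)) * (c * f) ≡ c * ((x - a) * f) ℤ.+ (m * c) * f
  regroup = solve-∀

P≡Σrook·falling : ∀ w x → P w (+ x) ≡ ΣR (#D w) (λ l → + rook w l * + (x P′ (#D w ∸ l)))
P≡Σrook·falling []      x = refl
P≡Σrook·falling (𝐔 ∷ w) x = P≡Σrook·falling w x
P≡Σrook·falling (𝐃 ∷ w) x = begin
  P (𝐃 ∷ w) (+ x)                 ≡⟨ P-𝐃 w (+ x) ⟩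
  c * P w (+ x)                   ≡⟨ ≡.cong (c *_) (P≡Σrook·falling w x) ⟩
  c * ΣR n (term w n)             ≡⟨ *-distribˡ-ΣR n c _ ⟩
  ΣR n (λ l → c * term w n l)     ≡⟨ ΣR-cong n c*term ⟩
  ΣR n (λ l → A l ℤ.+ B l)        ≡⟨ ΣR-distrib-+ n A B ⟩
  ΣR n A ℤ.+ ΣR n B               ≡⟨ ΣR-pascal n (term (𝐃 ∷ w) (suc n)) A B refl split A[1+n]≡0 ⟨
  ΣR (suc n) (term (𝐃 ∷ w) (suc n)) ∎
  where
  n = #D w
  m = #U w
  c = + x ℤ.+ + m - + n
  term : Word → ℕ → ℕ → ℤ
  term v e l = + rook v l * + (x P′ (e ∸ l))
  A B : ℕ → ℤ
  A l = term w (suc n) l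
  B l = + ((m ∸ l) ℕ.* rook w l) * + (x P′ (n ∸ l))
  A[1+n]≡0 : A (suc n) ≡ 0ℤ
  A[1+n]≡0 rewrite #D<k⇒rook≡0 w (ℕ.n<1+n n) = refl
  split : ∀ l → l ≤ n → term (𝐃 ∷ w) (suc n) (suc l) ≡ A (suc l) ℤ.+ B l
  split l _ = ≡.trans (≡.cong (_* F) (ℤ.pos-+ (rook w (suc l)) r))
                      (ℤ.*-distribʳ-+ F (+ rook w (suc l)) (+ r))
    where
    F = + (x P′ (n ∸ l))
    r = (m ∸ l) ℕ.* rook w l
  c*term : ∀ l → l ≤ n → c * term w n l ≡ A l ℤ.+ B l
  c*term l l≤n with l ℕ.≤? m
  ... | yes l≤m rewrite ℕ.+-∸-assoc 1 l≤n =
    falling-step x l (n ∸ l) (m ∸ l) (rook w l) (ℕ.m∸n+n≡m l≤m) (ℕ.m∸n+n≡m l≤n)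
  ... | no  l≰m rewrite #U<k⇒rook≡0 w (ℕ.≰⇒> l≰m) | ℕ.*-zeroʳ (m ∸ l) = ℤ.*-zeroʳ c

-1^ : ℕ → ℤ
-1^ k = (ℤ.- 1ℤ) ℤ.^ k

Δ^ : ℕ → (ℕ → ℤ) → ℕ → ℤ
Δ^ j f x = ΣR j (λ i → -1^ (j ∸ i) * + (j C i) * f (x ℕ.+ i))

Δ^-suc : ∀ j f x → Δ^ (suc j) f x ≡ Δ^ j f (suc x) - Δ^ j f x
Δ^-suc j f x = begin
  Δ^ (suc j) f x                          ≡⟨ ΣR-pascal j _ A _ refl pascal A[1+j]≡0 ⟩
  ΣR j A ℤ.+ Δ^ j f (suc x)               ≡⟨ ≡.cong (ℤ._+ Δ^ j f (suc x)) ΣA≡-Δ^ ⟩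
  ℤ.- Δ^ j f x ℤ.+ Δ^ j f (suc x)         ≡⟨ ℤ.+-comm (ℤ.- Δ^ j f x) _ ⟩
  Δ^ j f (suc x) - Δ^ j f x               ∎
  where
  A : ℕ → ℤ
  A i = -1^ (suc j ∸ i) * + (j C i) * f (x ℕ.+ i)
  A[1+j]≡0 : A (suc j) ≡ 0ℤ
  A[1+j]≡0 rewrite k>n⇒nCk≡0 (ℕ.n<1+n j) =
    ≡.trans (≡.cong (_* f (x ℕ.+ suc j)) (ℤ.*-zeroʳ (-1^ (j ∸ j)))) (ℤ.*-zeroˡ (f (x ℕ.+ suc j)))
  pascal : ∀ i → i ≤ j → -1^ (j ∸ i) * + (suc j C suc i) * f (x ℕ.+ suc i) ≡
                         A (suc i) ℤ.+ -1^ (j ∸ i) * + (j C i) * f (suc x ℕ.+ i)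
  pascal i _ rewrite ℕ.+-suc x i | ≡.sym (nCk+nC[k+1]≡[n+1]C[k+1] j i)
                   | ℤ.pos-+ (j C i) (j C suc i) = distrib (-1^ (j ∸ i)) (+ (j C i)) _ _
    where
    distrib : ∀ s a b y → s * (a ℤ.+ b) * y ≡ s * b * y ℤ.+ s * a * y
    distrib = solve-∀
  ΣA≡-Δ^ : ΣR j A ≡ ℤ.- Δ^ j f x
  ΣA≡-Δ^ = begin
    ΣR j A                                        ≡⟨ ΣR-cong j A≡-term ⟩
    ΣR j (λ i → ℤ.-1ℤ * (-1^ (j ∸ i) * + (j C i) * f (x ℕ.+ i)))
                                                  ≡⟨ *-distribˡ-ΣR j ℤ.-1ℤ _ ⟨
    ℤ.-1ℤ * Δ^ j f x                              ≡⟨ ℤ.-1*i≡-i _ ⟩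
    ℤ.- Δ^ j f x                                  ∎
    where
    A≡-term : ∀ i → i ≤ j → A i ≡ ℤ.-1ℤ * (-1^ (j ∸ i) * + (j C i) * f (x ℕ.+ i))
    A≡-term i i≤j rewrite ℕ.+-∸-assoc 1 i≤j = assoc ℤ.-1ℤ (-1^ (j ∸ i)) _ _
      where
      assoc : ∀ a s c y → a * s * c * y ≡ a * (s * c * y)
      assoc = solve-∀

Δ^-linear : ∀ j N (g : ℕ → ℤ) (h : ℕ → ℕ → ℤ) {f} x → (∀ y → f y ≡ ΣR N (λ l → g l * h l y)) →
            Δ^ j f x ≡ ΣR N (λ l → g l * Δ^ j (h l) x)
Δ^-linear j N g h {f} x f≡Σgh = begin
  ΣR j (λ i → s i * f (x ℕ.+ i))
    ≡⟨ ΣR-cong j (λ i _ → ≡.cong (s i *_) (f≡Σgh _)) ⟩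
  ΣR j (λ i → s i * ΣR N (λ l → g l * h l (x ℕ.+ i)))
    ≡⟨ ΣR-cong j (λ i _ → *-distribˡ-ΣR N (s i) _) ⟩
  ΣR j (λ i → ΣR N (λ l → s i * (g l * h l (x ℕ.+ i))))
    ≡⟨ ΣR-comm j N _ ⟩
  ΣR N (λ l → ΣR j (λ i → s i * (g l * h l (x ℕ.+ i))))
    ≡⟨ ΣR-cong N (λ l _ → ΣR-cong j (λ i _ → swap (s i) (g l) _)) ⟩
  ΣR N (λ l → ΣR j (λ i → g l * (s i * h l (x ℕ.+ i))))
    ≡⟨ ΣR-cong N (λ l _ → *-distribˡ-ΣR j (g l) _) ⟨
  ΣR N (λ l → g l * Δ^ j (h l) x)
    ∎
  where
  s : ℕ → ℤ
  s i = -1^ (j ∸ i) * + (j C i)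
  swap : ∀ a b c → a * (b * c) ≡ b * (a * c)
  swap = solve-∀

Δ^-falling : ∀ j a x → Δ^ j (λ y → + (y P′ a)) x ≡ + ((a P′ j) ℕ.* (x P′ (a ∸ j)))
Δ^-falling zero    a x = begin
  1ℤ * + ((x ℕ.+ 0) P′ a)   ≡⟨ ℤ.*-identityˡ _ ⟩
  + ((x ℕ.+ 0) P′ a)        ≡⟨ ≡.cong (λ y → + (y P′ a)) (ℕ.+-identityʳ x) ⟩
  + (x P′ a)                ≡⟨ ≡.cong +_ (ℕ.*-identityˡ (x P′ a)) ⟨
  + (1 ℕ.* (x P′ a))        ∎
Δ^-falling (suc j) a x = begin
  Δ^ (suc j) f x
    ≡⟨ Δ^-suc j f x ⟩
  Δ^ j f (suc x) - Δ^ j f x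
    ≡⟨ ≡.cong₂ _-_ (Δ^-falling j a (suc x)) (Δ^-falling j a x) ⟩
  + (p ℕ.* (suc x P′ (a ∸ j))) - + (p ℕ.* (x P′ (a ∸ j)))
    ≡⟨ difference (a ∸ j) ⟩
  + ((a ∸ j) ℕ.* p ℕ.* (x P′ pred (a ∸ j)))
    ≡⟨ ≡.cong (λ e → + ((a P′ suc j) ℕ.* (x P′ e))) (ℕ.pred[m∸n]≡m∸[1+n] a j) ⟩
  + ((a P′ suc j) ℕ.* (x P′ (a ∸ suc j)))
    ∎
  where
  f : ℕ → ℤ
  f y = + (y P′ a)
  p = a P′ j
  difference : ∀ b → + (p ℕ.* (suc x P′ b)) - + (p ℕ.* (x P′ b)) ≡ + (b ℕ.* p ℕ.* (x P′ pred b))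
  difference zero    = ℤ.+-inverseʳ (+ (p ℕ.* 1))
  difference (suc b) = begin
    + (p ℕ.* (suc x P′ suc b)) - + (p ℕ.* (x P′ suc b))
      ≡⟨ ≡.cong₂ _-_ (ℤ.pos-* p _) (ℤ.pos-* p _) ⟩
    + p * + (suc x P′ suc b) - + p * + (x P′ suc b)
      ≡⟨ ≡.cong (λ z → + p * z - + p * + (x P′ suc b)) (P′-suc-suc x b) ⟩
    + p * (+ (x P′ suc b) ℤ.+ + suc b * + (x P′ b)) - + p * + (x P′ suc b)
      ≡⟨ cancel (+ p) (+ (x P′ suc b)) (+ suc b) (+ (x P′ b)) ⟩
    + suc b * + p * + (x P′ b)
      ≡⟨ ≡.cong (_* + (x P′ b)) (ℤ.pos-* (suc b) p) ⟨
    + (suc b ℕ.* p) * + (x P′ b)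
      ≡⟨ ℤ.pos-* (suc b ℕ.* p) _ ⟨
    + (suc b ℕ.* p ℕ.* (x P′ b))
      ∎
    where
    cancel : ∀ p y b z → p * (y ℤ.+ b * z) - p * y ≡ b * p * z
    cancel = solve-∀

a≢j⇒aP′j*0P′[a∸j]≡0 : ∀ {a j} → ¬ a ≡ j → (a P′ j) ℕ.* (0 P′ (a ∸ j)) ≡ 0
a≢j⇒aP′j*0P′[a∸j]≡0 {a} {j} a≢j with ℕ.<-cmp a j
... | tri< a<j _ _ rewrite <⇒P′≡0 a<j = refl
... | tri≈ _ a≡j _ = ⊥-elim (a≢j a≡j)
... | tri> _ _ j<a rewrite <⇒P′≡0 (ℕ.m<n⇒0<n∸m j<a) = ℕ.*-zeroʳ (a P′ j)

Σℤ≡ΣR : ∀ N f → Σℤ N f ≡ ΣR N f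
Σℤ≡ΣR zero    f = refl
Σℤ≡ΣR (suc N) f = ≡.cong (ℤ._+ f (suc N)) (Σℤ≡ΣR N f)

S≡[n∸k]!*rook : ∀ w {k} → k ≤ #D w → S w k ≡ + ((#D w ∸ k) !) * + rook w k
S≡[n∸k]!*rook w {k} k≤n = begin
  S w k
    ≡⟨ Σℤ≡ΣR j _ ⟩
  Δ^ j (λ y → P w (+ y)) 0
    ≡⟨ Δ^-linear j n (λ l → + rook w l) _ 0 (P≡Σrook·falling w) ⟩
  ΣR n (λ l → + rook w l * Δ^ j (λ y → + (y P′ (n ∸ l))) 0)
    ≡⟨ ΣR-cong n (λ l _ → ≡.cong (+ rook w l *_) (Δ^-falling j (n ∸ l) 0)) ⟩
  ΣR n (λ l → + rook w l * + (((n ∸ l) P′ j) ℕ.* (0 P′ (n ∸ l ∸ j))))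
    ≡⟨ ΣR-single n _ k≤n off-diagonal ⟩
  + rook w k * + ((j P′ j) ℕ.* (0 P′ (j ∸ j)))
    ≡⟨ ≡.cong (λ e → + rook w k * + ((j P′ j) ℕ.* (0 P′ e))) (ℕ.n∸n≡0 j) ⟩
  + rook w k * + ((j P′ j) ℕ.* 1)
    ≡⟨ ≡.cong (λ e → + rook w k * + e) (≡.trans (ℕ.*-identityʳ _) (nP′n≡n! j)) ⟩
  + rook w k * + (j !)
    ≡⟨ ℤ.*-comm (+ rook w k) _ ⟩
  + (j !) * + rook w k
    ∎
  where
  n = #D w
  j = n ∸ k
  off-diagonal : ∀ l → l ≤ n → ¬ l ≡ k → + rook w l * + (((n ∸ l) P′ j) ℕ.* (0 P′ (n ∸ l ∸ j))) ≡ 0ℤ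
  off-diagonal l l≤n l≢k rewrite a≢j⇒aP′j*0P′[a∸j]≡0 (λ eq → l≢k (ℕ.∸-cancelˡ-≡ l≤n k≤n eq)) =
    ℤ.*-zeroʳ (+ rook w l)

open import Data.Product using (Σ-syntax; _×_; _,_)

mainTheorem2 : ∀ {c ℓ} (R : Ring c ℓ) (d u : Ring.Carrier R) →
    Ring._≈_ R (Ring._*_ R d u) (Ring._+_ R (Ring._*_ R u d) (Ring.1# R)) →
    (w : Word) →
    Σ[ r ∈ (ℕ → ℤ) ]
      ((∀ k → k ≤ #D w → + ((#D w ∸ k) !) * r k ≡ S w k) ×
       (∀ k → k ≤ #D w → #U w < k → r k ≡ 0ℤ) ×
       Ring._≈_ R (RingOps.eval R d u w)
         (RingOps.ΣR R (#D w) (λ k →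
           Ring._*_ R (RingOps.ℤ→R R (r k))
             (Ring._*_ R (RingOps.pow R u (#U w ∸ k)) (RingOps.pow R d (#D w ∸ k))))))
mainTheorem2 R d u du≈ud+1 w =
  (λ k → + rook w k) ,
  (λ k k≤n → ≡.sym (S≡[n∸k]!*rook w k≤n)) ,
  (λ k _ m<k → ≡.cong +_ (#U<k⇒rook≡0 w m<k)) ,
  Ring.trans R (normalOrdering w)
    (ΣR-Properties.ΣR-cong R (#D w) (λ k _ → Ring.sym R (ℕ→R-*≈× (rook w k) _)))
  where open NormalOrdering R d u du≈ud+1
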